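{- Let $k\ge 2$ be an integer and let $G$ be a diameter-$k$-critical graph. For every edge $e$ of $G$ there exists a path $P$ of length $\lceil k/3\rceil$, with endpoints $x,y$, such that $d_G(x,y)\le \lceil k/3\rceil$ and $d_{G-e}(x,y)>\lceil k/3\rceil$.
   Context: All graphs are finite and simple. $d_G(x,y)$ is the length of a shortest $(x,y)$-path in $G$ ($\infty$ if none). The diameter of $G$ is the maximum of $d_G(x,y)$ over vertex pairs. $G$ is diameter-$k$-critical if its diameter is $k$ and for every edge $e$, $G-e$ has diameter strictly greater than $k$. (In the paper's terminology, $e$ is $\lceil k/3\rceil$-associated with $P$.) -}

module Defs where

open import Data.Nat using (ℕ; zero; suc; _≤_; _<_; _+_)
open import Data.Nat.DivMod using (_/_)
open import Data.Fin using (Fin; zero; suc; inject₁; fromℕ)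
open import Data.Product using (Σ; ∃; ∃-syntax; _×_; _,_)
open import Data.Sum using (_⊎_)
open import Relation.Nullary using (¬_; Dec)
open import Relation.Binary.PropositionalEquality using (_≡_)
open import Function.Definitions using (Injective)

record Graph : Set₁ where
  field
    n     : ℕ
    Adj   : Fin n → Fin n → Set
    dec   : ∀ u v → Dec (Adj u v)
    sym   : ∀ {u v} → Adj u v → Adj v u
    irrefl : ∀ {u} → ¬ Adj u u

open Graph public

-- An edge of G: an ordered pair of adjacent vertices (representing {u,v}).
Edge : Graph → Set
Edge G = Σ (Fin (n G)) λ u → Σ (Fin (n G)) λ v → Adj G u v

SameEdge : {m : ℕ} → Fin m → Fin m → Fin m → Fin m → Set
SameEdge u v a b = (a ≡ u × b ≡ v) ⊎ (a ≡ v × b ≡ u)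

_─_ : (G : Graph) → Edge G → Graph
G ─ (u , v , _) = record
  { n = n G
  ; Adj = λ a b → Adj G a b × ¬ SameEdge u v a b
  ; dec = decAdj
  ; sym = λ { (p , q) → sym G p , λ s → q (swap s) }
  ; irrefl = λ { (p , _) → irrefl G p }
  }
  where
  open import Relation.Nullary using (yes; no)
  open import Relation.Nullary.Decidable using (_×-dec_; ¬?; _⊎-dec_)
  open import Data.Fin using (_≟_)
  open import Data.Sum using (inj₁; inj₂)
  decAdj : ∀ a b → Dec (Adj G a b × ¬ SameEdge u v a b)
  decAdj a b = dec G a b ×-dec ¬? (((a ≟ u) ×-dec (b ≟ v)) ⊎-dec ((a ≟ v) ×-dec (b ≟ u)))
  swap : ∀ {a b} → SameEdge u v b a → SameEdge u v a b
  swap (inj₁ (p , q)) = inj₂ (q , p)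
  swap (inj₂ (p , q)) = inj₁ (q , p)

record Path (G : Graph) (x y : Fin (n G)) (l : ℕ) : Set where
  field
    vert  : Fin (suc l) → Fin (n G)
    start : vert zero ≡ x
    end   : vert (fromℕ l) ≡ y
    step  : ∀ (i : Fin l) → Adj G (vert (inject₁ i)) (vert (suc i))
    distinct : Injective _≡_ _≡_ vert

-- d_G(x,y) ≤ m  (false when d_G(x,y) = ∞)
Dist≤ : (G : Graph) → Fin (n G) → Fin (n G) → ℕ → Set
Dist≤ G x y m = ∃[ l ] (l ≤ m × Path G x y l)

DistEq : (G : Graph) → Fin (n G) → Fin (n G) → ℕ → Set
DistEq G x y d = Path G x y d × (∀ l → l < d → ¬ Path G x y l)

HasDiameter : Graph → ℕ → Set
HasDiameter G k = (∀ x y → Dist≤ G x y k) × ∃[ x ] ∃[ y ] DistEq G x y k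

-- diam G > k (includes diam G = ∞)
DiameterGt : Graph → ℕ → Set
DiameterGt G k = ∃[ x ] ∃[ y ] ¬ Dist≤ G x y k

DiameterCritical : ℕ → Graph → Set
DiameterCritical k G = HasDiameter G k × (∀ (e : Edge G) → DiameterGt (G ─ e) k)

⌈_/3⌉ : ℕ → ℕ
⌈ k /3⌉ = (k + 2) / 3

-- Write e = cd, t = ⌈k/3⌉ = r + 1 (so 3r < k), and let a, b be the pair with d_{G−e}(a,b) > k
-- given by criticality. An a–b path Q of length ≤ k in G must use e, so Q = Q₁ e Q₂ with Q₁, Q₂
-- avoiding e. If a segment R of Q (containing e) had a short bypass in G − e, replacing R by it
-- would give an a–b walk in G − e of length ≤ k. So when |Q| ≥ t, any segment of length t through
-- e is the required path; when |Q| ≤ r, the same argument shows that G − e has no c–d walk of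
-- length ≤ 2r + 1. In the latter case, as some pair p, q has d(p,q) = k > 2r, some z has
-- d(c,z) > r; a c–z path S yields a path B of length r from one end of e missing the other end
-- (a prefix of S, or of the part of S after d), and e followed by B is the required path: a short
-- bypass of it in G − e, closed up along B, would be a c–d walk of length ≤ 2r + 1 in G − e.

module Submission where

open import Defs hiding (sym)
open import Data.Nat using (ℕ; zero; suc; _+_; _*_; _∸_; _⊓_; _≤_; _<_; _≤?_; z≤n; s≤s)
open import Data.Nat.Properties
  using ( +-comm; +-suc; +-assoc; suc-injective; ≤-refl; ≤-trans; ≤-<-trans; ≤-pred; <⇒≤; ≰⇒>
        ; m≤n⇒m≤1+n; m≤n+m; m≤m+n; +-mono-≤; +-monoˡ-≤; +-cancelʳ-≤; m∸n+n≡m; m+[n∸m]≡n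
        ; m≤n+o⇒m∸n≤o; m⊓n≤m; m⊓n+n∸m≡n; module ≤-Reasoning )
open import Data.Nat.DivMod using (m/n*n≤m; /-monoˡ-≤)
open import Data.Nat.Tactic.RingSolver using (solve-∀)
open import Data.Fin using (Fin; zero; suc; inject₁; fromℕ)
import Data.Fin.Properties as Fin
open import Data.List using (List; []; _∷_; tabulate)
open import Data.List.Membership.Propositional using (_∈_; _∉_)
open import Data.List.Relation.Unary.Any using (here; there)
import Data.List.Relation.Unary.Any as Any
open import Data.List.Relation.Unary.All using ([]; _∷_)
import Data.List.Relation.Unary.All as All
import Data.List.Relation.Unary.All.Properties as All
open import Data.List.Relation.Unary.All.Properties.Core using (All¬⇒¬Any; ¬Any⇒All¬)
open import Data.List.Relation.Unary.Unique.Propositional using (Unique; []; _∷_)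
import Data.List.Relation.Unary.Unique.Propositional.Properties as Unique
open import Data.Product using (Σ; ∃; ∃-syntax; _×_; _,_; proj₁; proj₂)
open import Data.Sum using (_⊎_; inj₁; inj₂)
open import Data.Unit using (⊤; tt)
open import Data.Empty using (⊥-elim)
open import Function using (_∘_)
open import Function.Definitions using (Injective)
open import Relation.Nullary using (¬_; Dec; yes; no)
open import Relation.Nullary.Decidable using (_×-dec_; _⊎-dec_)
open import Relation.Binary.PropositionalEquality

Unique-tabulate⁻ : ∀ {A : Set} {k} {f : Fin k → A} → Unique (tabulate f) → Injective _≡_ _≡_ f
Unique-tabulate⁻ {k = suc _} _         {zero}  {zero}  _     = refl
Unique-tabulate⁻ {k = suc _} (f₀∉ ∷ _) {zero}  {suc j} f₀≡fj = ⊥-elim (All.tabulate⁻ f₀∉ j f₀≡fj)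
Unique-tabulate⁻ {k = suc _} (f₀∉ ∷ _) {suc i} {zero}  fi≡f₀ =
  ⊥-elim (All.tabulate⁻ f₀∉ i (sym fi≡f₀))
Unique-tabulate⁻ {k = suc _} (_ ∷ u)   {suc i} {suc j} fi≡fj = cong suc (Unique-tabulate⁻ u fi≡fj)

private variable
  H : Graph

infixr 5 _∷_ _++_

data Walk (H : Graph) : Fin (n H) → Fin (n H) → Set where
  []  : ∀ {x} → Walk H x x
  _∷_ : ∀ {x y z} → Adj H x y → Walk H y z → Walk H x z

len : ∀ {x y} → Walk H x y → ℕ
len []      = 0
len (_ ∷ w) = suc (len w)

_++_ : ∀ {x y z} → Walk H x y → Walk H y z → Walk H x z
[]      ++ w′ = w′
(e ∷ w) ++ w′ = e ∷ (w ++ w′)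

len-++ : ∀ {x y z} (w : Walk H x y) (w′ : Walk H y z) → len (w ++ w′) ≡ len w + len w′
len-++ []      w′ = refl
len-++ (_ ∷ w) w′ = cong suc (len-++ w w′)

++-assoc : ∀ {x y z x′} (w₁ : Walk H x y) (w₂ : Walk H y z) (w₃ : Walk H z x′) →
           (w₁ ++ w₂) ++ w₃ ≡ w₁ ++ (w₂ ++ w₃)
++-assoc []      w₂ w₃ = refl
++-assoc (e ∷ w) w₂ w₃ = cong (e ∷_) (++-assoc w w₂ w₃)

reverse : ∀ {x y} → Walk H x y → Walk H y x
reverse         []      = []
reverse {H = H} (e ∷ w) = reverse w ++ (Graph.sym H e ∷ [])

len-reverse : ∀ {x y} (w : Walk H x y) → len (reverse w) ≡ len w
len-reverse []      = refl
len-reverse (e ∷ w) = begin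
  len (reverse w ++ _ ∷ []) ≡⟨ len-++ (reverse w) _ ⟩
  len (reverse w) + 1       ≡⟨ +-comm (len (reverse w)) 1 ⟩
  suc (len (reverse w))     ≡⟨ cong suc (len-reverse w) ⟩
  suc (len w)               ∎
  where open ≡-Reasoning

vertex : ∀ {x y} (w : Walk H x y) → Fin (suc (len w)) → Fin (n H)
vertex {x = x} []      zero    = x
vertex {x = x} (_ ∷ w) zero    = x
vertex         (_ ∷ w) (suc i) = vertex w i

AdjacentSteps : ∀ H {l} → (Fin (suc l) → Fin (n H)) → Set
AdjacentSteps H {l} f = (i : Fin l) → Adj H (f (inject₁ i)) (f (suc i))

vertex-start : ∀ {x y} (w : Walk H x y) → vertex w zero ≡ x
vertex-start []      = refl
vertex-start (_ ∷ _) = refl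

vertex-end : ∀ {x y} (w : Walk H x y) → vertex w (fromℕ (len w)) ≡ y
vertex-end []      = refl
vertex-end (_ ∷ w) = vertex-end w

vertex-step : ∀ {x y} (w : Walk H x y) → AdjacentSteps H (vertex w)
vertex-step {H = H} (e ∷ w) zero    = subst (Adj H _) (sym (vertex-start w)) e
vertex-step         (_ ∷ w) (suc i) = vertex-step w i

verts : ∀ {x y} → Walk H x y → List (Fin (n H))
verts w = tabulate (vertex w)

IsPath : ∀ {x y} → Walk H x y → Set
IsPath w = Unique (verts w)

∈-++⁺ˡ : ∀ {x y z v} (w : Walk H x y) (w′ : Walk H y z) → v ∈ verts w → v ∈ verts (w ++ w′)
∈-++⁺ˡ []      w′ (here v≡x) = here (trans v≡x (sym (vertex-start w′)))
∈-++⁺ˡ (_ ∷ w) w′ (here v≡x) = here v≡x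
∈-++⁺ˡ (_ ∷ w) w′ (there v∈w) = there (∈-++⁺ˡ w w′ v∈w)

∈-++⁺ʳ : ∀ {x y z v} (w : Walk H x y) (w′ : Walk H y z) → v ∈ verts w′ → v ∈ verts (w ++ w′)
∈-++⁺ʳ []      w′ v∈w′ = v∈w′
∈-++⁺ʳ (_ ∷ w) w′ v∈w′ = there (∈-++⁺ʳ w w′ v∈w′)

IsPath-++⁻ˡ : ∀ {x y z} (w : Walk H x y) (w′ : Walk H y z) → IsPath (w ++ w′) → IsPath w
IsPath-++⁻ˡ []      w′ _         = [] ∷ []
IsPath-++⁻ˡ (_ ∷ w) w′ (x∉ ∷ ww′) =
  All.anti-mono (∈-++⁺ˡ w w′) x∉ ∷ IsPath-++⁻ˡ w w′ ww′

IsPath-++⁻ʳ : ∀ {x y z} (w : Walk H x y) (w′ : Walk H y z) → IsPath (w ++ w′) → IsPath w′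
IsPath-++⁻ʳ []      w′ ww′       = ww′
IsPath-++⁻ʳ (_ ∷ w) w′ (_ ∷ ww′) = IsPath-++⁻ʳ w w′ ww′

start∉-++⁻ʳ : ∀ {x y z} (w : Walk H x y) (w′ : Walk H y z) → IsPath (w ++ w′) → x ≢ y → x ∉ verts w′
start∉-++⁻ʳ []      w′ _          x≢x = ⊥-elim (x≢x refl)
start∉-++⁻ʳ (_ ∷ w) w′ (x∉ ∷ _) _ x∈w′ = All.lookup x∉ (∈-++⁺ʳ w w′ x∈w′) refl

len-++-≥ʳ : ∀ {x y z} (w : Walk H x y) (w′ : Walk H y z) → len w′ ≤ len (w ++ w′)
len-++-≥ʳ w w′ = subst (len w′ ≤_) (sym (len-++ w w′)) (m≤n+m (len w′) (len w))

data Split {H} {x y : Fin (n H)} (m₁ m₂ : ℕ) : Walk H x y → Set where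
  split : ∀ {z} (w₁ : Walk H x z) (w₂ : Walk H z y) → len w₁ ≡ m₁ → len w₂ ≡ m₂ →
          Split m₁ m₂ (w₁ ++ w₂)

splitAt : ∀ {x y} m₁ m₂ (w : Walk H x y) → len w ≡ m₁ + m₂ → Split m₁ m₂ w
splitAt zero     m₂ w       eq = split [] w refl eq
splitAt (suc m₁) m₂ (e ∷ w) eq with splitAt m₁ m₂ w (suc-injective eq)
... | split w₁ w₂ refl refl = split (e ∷ w₁) w₂ refl refl

data Through {H} {x y : Fin (n H)} (v : Fin (n H)) : Walk H x y → Set where
  through : (w₁ : Walk H x v) (w₂ : Walk H v y) → Through v (w₁ ++ w₂)

∈⇒Through : ∀ {x y v} (w : Walk H x y) → v ∈ verts w → Through v w
∈⇒Through []      (here refl) = through [] []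
∈⇒Through (e ∷ w) (here refl) = through [] (e ∷ w)
∈⇒Through (e ∷ w) (there v∈w) with ∈⇒Through w v∈w
... | through w₁ w₂ = through (e ∷ w₁) w₂

walk⇒path : ∀ {x y} (w : Walk H x y) → Σ (Walk H x y) λ p → IsPath p × len p ≤ len w
walk⇒path         []      = [] , [] ∷ [] , z≤n
walk⇒path {x = x} (e ∷ w) with walk⇒path w
... | p , p-path , p≤w with Any.any? (x Fin.≟_) (verts p)
...   | no  x∉p = e ∷ p , ¬Any⇒All¬ _ x∉p ∷ p-path , s≤s p≤w
...   | yes x∈p with ∈⇒Through p x∈p
...     | through p₁ p₂ = p₂ , IsPath-++⁻ʳ p₁ p₂ p-path , ≤-trans (len-++-≥ʳ p₁ p₂) (m≤n⇒m≤1+n p≤w)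

Reach : (H : Graph) → Fin (n H) → Fin (n H) → ℕ → Set
Reach H x y m = Σ (Walk H x y) λ w → len w ≤ m

reach? : ∀ x y m → Dec (Reach H x y m)
reach?         x y m with x Fin.≟ y
reach?         x .x m       | yes refl = yes ([] , z≤n)
reach?         x y  zero    | no  x≢y  = no λ { ([] , _) → x≢y refl ; (_ ∷ _ , ()) }
reach? {H = H} x y  (suc m) | no  x≢y  with Fin.any? (λ z → Graph.dec H x z ×-dec reach? z y m)
... | yes (z , e , w , w≤m) = yes (e ∷ w , s≤s w≤m)
... | no  ∄z               = no λ { ([] , _) → x≢y refl ; (e ∷ w , s≤s w≤m) → ∄z (_ , e , w , w≤m) }

path⇒Path : ∀ {x y} (w : Walk H x y) → IsPath w → Path H x y (len w)
path⇒Path w w-path = record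
  { vert     = vertex w
  ; start    = vertex-start w
  ; end      = vertex-end w
  ; step     = vertex-step w
  ; distinct = Unique-tabulate⁻ w-path
  }

walkAlong : ∀ H l (f : Fin (suc l) → Fin (n H)) → AdjacentSteps H f → Walk H (f zero) (f (fromℕ l))
walkAlong H zero    f step = []
walkAlong H (suc l) f step = step zero ∷ walkAlong H l (f ∘ suc) (step ∘ suc)

len-walkAlong : ∀ H l (f : Fin (suc l) → Fin (n H)) step → len (walkAlong H l f step) ≡ l
len-walkAlong H zero    f step = refl
len-walkAlong H (suc l) f step = cong suc (len-walkAlong H l (f ∘ suc) (step ∘ suc))

verts-walkAlong : ∀ H l (f : Fin (suc l) → Fin (n H)) step → verts (walkAlong H l f step) ≡ tabulate f
verts-walkAlong H zero    f step = refl
verts-walkAlong H (suc l) f step = cong (f zero ∷_) (verts-walkAlong H l (f ∘ suc) (step ∘ suc))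

Path⇒path : ∀ {x y l} → Path H x y l → Σ (Walk H x y) λ w → IsPath w × len w ≡ l
Path⇒path {H = H} {l = l}
  record { vert = f ; start = refl ; end = refl ; step = step ; distinct = f-inj } =
  walkAlong H l f step ,
  subst Unique (sym (verts-walkAlong H l f step)) (Unique.tabulate⁺ f-inj) ,
  len-walkAlong H l f step

Reach⇒Dist≤ : ∀ {x y m} → Reach H x y m → Dist≤ H x y m
Reach⇒Dist≤ (w , w≤m) with walk⇒path w
... | p , p-path , p≤w = len p , ≤-trans p≤w w≤m , path⇒Path p p-path

Dist≤⇒path : ∀ {x y m} → Dist≤ H x y m → Σ (Walk H x y) λ p → IsPath p × len p ≤ m
Dist≤⇒path (l , l≤m , P) with Path⇒path P
... | p , p-path , refl = p , p-path , l≤m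

Dist≤⇒Reach : ∀ {x y m} → Dist≤ H x y m → Reach H x y m
Dist≤⇒Reach dist with Dist≤⇒path dist
... | p , _ , p≤m = p , p≤m

Reach-mono : ∀ {x y m m′} → m ≤ m′ → Reach H x y m → Reach H x y m′
Reach-mono m≤m′ (w , w≤m) = w , ≤-trans w≤m m≤m′

Reach-sym : ∀ {x y m} → Reach H x y m → Reach H y x m
Reach-sym (w , w≤m) = reverse w , subst (_≤ _) (sym (len-reverse w)) w≤m

Reach-trans : ∀ {x y z m m′} → Reach H x y m → Reach H y z m′ → Reach H x z (m + m′)
Reach-trans (w , w≤m) (w′ , w′≤m′) = w ++ w′ , subst (_≤ _) (sym (len-++ w w′)) (+-mono-≤ w≤m w′≤m′)

DistEq⇒¬Reach : ∀ {x y k m} → DistEq H x y k → m < k → ¬ Reach H x y m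
DistEq⇒¬Reach (_ , no-shorter) m<k reach with Reach⇒Dist≤ reach
... | l , l≤m , P = no-shorter l (≤-<-trans l≤m m<k) P

far-vertex : ∀ {p q} r → ¬ Reach H p q (r + r) → ∀ c → ∃ λ z → ¬ Reach H c z r
far-vertex {p = p} {q} r p↛q c with reach? c p r | reach? c q r
... | no  c↛p | _        = p , c↛p
... | yes _    | no  c↛q = q , c↛q
... | yes c→p  | yes c→q = ⊥-elim (p↛q (Reach-trans (Reach-sym c→p) c→q))

¬Reach⇒longer : ∀ {x y m} → ¬ Reach H x y m → (w : Walk H x y) → m < len w
¬Reach⇒longer x↛y w = ≰⇒> (λ w≤m → x↛y (w , w≤m))

split-sum : ∀ {r i j} → r ≤ i + j → Σ ℕ λ s₁ → Σ ℕ λ s₂ → s₁ ≤ i × s₂ ≤ j × s₁ + s₂ ≡ r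
split-sum {r} {i} {j} r≤i+j =
  r ∸ j , j ⊓ r , m≤n+o⇒m∸n≤o r j (subst (r ≤_) (+-comm i j) r≤i+j) , m⊓n≤m j r ,
  trans (+-comm (r ∸ j) (j ⊓ r)) (m⊓n+n∸m≡n j r)

detour-bound : ∀ {i j r k} → i + j < r → r + r + r < k → i + (suc r + r + j) ≤ k
detour-bound {i} {j} {r} {k} i+j<r 3r<k = begin
  i + (suc r + r + j)     ≡⟨ regroup i j r ⟩
  suc (i + j) + (r + r)   ≤⟨ +-monoˡ-≤ (r + r) i+j<r ⟩
  r + (r + r)             ≡⟨ +-assoc r r r ⟨
  r + r + r               ≤⟨ <⇒≤ 3r<k ⟩
  k                       ∎
  where
  open ≤-Reasoning
  regroup : ∀ i j r → i + (suc r + r + j) ≡ suc (i + j) + (r + r)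
  regroup = solve-∀

module Deletion (G : Graph) {u v : Fin (n G)} (uv : Adj G u v) where

  G′ : Graph
  G′ = G ─ (u , v , uv)

  Avoids : ∀ {x y} → Walk G x y → Set
  Avoids []                = ⊤
  Avoids (_∷_ {x} {y} _ w) = ¬ SameEdge u v x y × Avoids w

  liftReach : ∀ {x y} (w : Walk G x y) → Avoids w → Reach G′ x y (len w)
  liftReach []      _                  = [] , z≤n
  liftReach (e ∷ w) (¬same , w-avoids) with liftReach w w-avoids
  ... | w′ , w′≤w = (e , ¬same) ∷ w′ , s≤s w′≤w

  Avoids-++⁻ : ∀ {x y z} (w : Walk G x y) (w′ : Walk G y z) →
               Avoids (w ++ w′) → Avoids w × Avoids w′
  Avoids-++⁻ []      w′ ww′-avoids           = tt , ww′-avoids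
  Avoids-++⁻ (_ ∷ w) w′ (¬same , ww′-avoids) =
    (¬same , proj₁ (Avoids-++⁻ w w′ ww′-avoids)) , proj₂ (Avoids-++⁻ w w′ ww′-avoids)

  Endpoint : Fin (n G) → Set
  Endpoint c = c ≡ u ⊎ c ≡ v

  SameEdge-endpoint : ∀ {a b c} → SameEdge u v a b → Endpoint c → c ≡ a ⊎ c ≡ b
  SameEdge-endpoint (inj₁ (refl , refl)) (inj₁ refl) = inj₁ refl
  SameEdge-endpoint (inj₁ (refl , refl)) (inj₂ refl) = inj₂ refl
  SameEdge-endpoint (inj₂ (refl , refl)) (inj₁ refl) = inj₂ refl
  SameEdge-endpoint (inj₂ (refl , refl)) (inj₂ refl) = inj₁ refl

  SameEdge-start : ∀ {a b} → SameEdge u v a b → Endpoint a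
  SameEdge-start (inj₁ (a≡u , _)) = inj₁ a≡u
  SameEdge-start (inj₂ (a≡v , _)) = inj₂ a≡v

  SameEdge-end : ∀ {a b} → SameEdge u v a b → Endpoint b
  SameEdge-end (inj₁ (_ , b≡v)) = inj₂ b≡v
  SameEdge-end (inj₂ (_ , b≡u)) = inj₁ b≡u

  ∉⇒Avoids : ∀ {c x y} → Endpoint c → (w : Walk G x y) → c ∉ verts w → Avoids w
  ∉⇒Avoids c-end []                _  = tt
  ∉⇒Avoids c-end (_∷_ {x} {y} _ w) c∉ = ¬same , ∉⇒Avoids c-end w (c∉ ∘ there)
    where
    ¬same : ¬ SameEdge u v x y
    ¬same same with SameEdge-endpoint same c-end
    ... | inj₁ c≡x = c∉ (here c≡x)
    ... | inj₂ c≡y = c∉ (there (here (trans c≡y (sym (vertex-start w)))))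

  sameEdge? : ∀ a b → Dec (SameEdge u v a b)
  sameEdge? a b = ((a Fin.≟ u) ×-dec (b Fin.≟ v)) ⊎-dec ((a Fin.≟ v) ×-dec (b Fin.≟ u))

  data Crossing {a b} : Walk G a b → Set where
    crossing : ∀ {c d} (w₁ : Walk G a c) (e : Adj G c d) (w₂ : Walk G d b) → SameEdge u v c d →
               Avoids w₁ → Avoids w₂ → Crossing (w₁ ++ e ∷ w₂)

  avoids-or-crosses : ∀ {a b} (w : Walk G a b) → IsPath w → Avoids w ⊎ Crossing w
  avoids-or-crosses [] _ = inj₁ tt
  avoids-or-crosses (_∷_ {a} {a′} e w) (a∉ ∷ w-path) with sameEdge? a a′
  ... | yes same = inj₂ (crossing [] e w same tt (∉⇒Avoids (SameEdge-start same) w (All¬⇒¬Any a∉)))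
  ... | no ¬same with avoids-or-crosses w w-path
  ...   | inj₁ w-avoids = inj₁ (¬same , w-avoids)
  ...   | inj₂ (crossing w₁ e′ w₂ same w₁-avoids w₂-avoids) =
          inj₂ (crossing (e ∷ w₁) e′ w₂ same (¬same , w₁-avoids) w₂-avoids)

  Witness : ℕ → Set
  Witness t = ∃[ x ] ∃[ y ] (Path G x y t × Dist≤ G x y t × ¬ Dist≤ G′ x y t)

  witness : ∀ {x y} (p : Walk G x y) → IsPath p → ¬ Reach G′ x y (len p) → Witness (len p)
  witness p p-path x↛y = _ , _ , P , (len p , ≤-refl , P) , x↛y ∘ Dist≤⇒Reach
    where P = path⇒Path p p-path

  edge-extension : ∀ {c c′ y} (e : Adj G c′ c) → Endpoint c′ →
                   (B : Walk G c y) → IsPath B → c′ ∉ verts B →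
                   ¬ Reach G′ c′ c (suc (len B) + len B) → Witness (suc (len B))
  edge-extension e c′-end B B-path c′∉B c′↛c =
    witness (e ∷ B) (¬Any⇒All¬ _ c′∉B ∷ B-path)
      (λ c′→y → c′↛c (Reach-trans c′→y (Reach-sym (liftReach B (∉⇒Avoids c′-end B c′∉B)))))

  module _ {a b k} (a↛b : ¬ Reach G′ a b k) where

    no-short-bypass : ∀ {x y m} (w₁ : Walk G a x) (w₂ : Walk G y b) → Avoids w₁ → Avoids w₂ →
                      len w₁ + (m + len w₂) ≤ k → ¬ Reach G′ x y m
    no-short-bypass w₁ w₂ w₁-avoids w₂-avoids bound x→y =
      a↛b (Reach-mono bound
        (Reach-trans (liftReach w₁ w₁-avoids) (Reach-trans x→y (liftReach w₂ w₂-avoids))))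

    segment-witness : ∀ {x y} (w₁ : Walk G a x) (R : Walk G x y) (w₂ : Walk G y b) →
                      IsPath (w₁ ++ R ++ w₂) → len (w₁ ++ R ++ w₂) ≤ k →
                      Avoids w₁ → Avoids w₂ → Witness (len R)
    segment-witness w₁ R w₂ path short w₁-avoids w₂-avoids =
      witness R (IsPath-++⁻ˡ R w₂ (IsPath-++⁻ʳ w₁ (R ++ w₂) path))
        (no-short-bypass w₁ w₂ w₁-avoids w₂-avoids
          (subst (_≤ k) (trans (len-++ w₁ _) (cong (len w₁ +_) (len-++ R w₂))) short))

    long-crossing-witness : ∀ {r c d} (w₁ : Walk G a c) (e : Adj G c d) (w₂ : Walk G d b) →
                      IsPath (w₁ ++ e ∷ w₂) → len (w₁ ++ e ∷ w₂) ≤ k → Avoids w₁ → Avoids w₂ →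
                      r ≤ len w₁ + len w₂ → Witness (suc r)
    long-crossing-witness w₁ e w₂ path short w₁-avoids w₂-avoids r≤ with split-sum r≤
    ... | s₁ , s₂ , s₁≤ , s₂≤ , s₁+s₂≡r
      with splitAt _ s₁ w₁ (sym (m∸n+n≡m s₁≤)) | splitAt s₂ _ w₂ (sym (m+[n∸m]≡n s₂≤))
    ... | split A₁ B₁ _ refl | split B₂ A₂ refl _ =
      subst Witness (trans (len-++ B₁ (e ∷ B₂)) (trans (+-suc _ _) (cong suc s₁+s₂≡r)))
        (segment-witness A₁ (B₁ ++ e ∷ B₂) A₂
          (subst IsPath reassoc path) (subst (λ w → len w ≤ k) reassoc short)
          (proj₁ (Avoids-++⁻ A₁ B₁ w₁-avoids)) (proj₂ (Avoids-++⁻ B₂ A₂ w₂-avoids)))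
      where
      reassoc : (A₁ ++ B₁) ++ e ∷ (B₂ ++ A₂) ≡ A₁ ++ (B₁ ++ e ∷ B₂) ++ A₂
      reassoc = trans (++-assoc A₁ B₁ _) (cong (A₁ ++_) (sym (++-assoc B₁ (e ∷ B₂) A₂)))

  short-crossing-witness : ∀ {r c d z} (e : Adj G c d) → SameEdge u v c d →
                           ¬ Reach G′ c d (suc r + r) → ¬ Reach G c z r →
                           (S : Walk G c z) → IsPath S → Witness (suc r)
  short-crossing-witness {r} {c} {d} e same c↛d c↛z S S-path with Any.any? (d Fin.≟_) (verts S)
  ... | no d∉S with splitAt r _ S (sym (m+[n∸m]≡n (<⇒≤ (¬Reach⇒longer c↛z S))))
  ...   | split B C refl _ =
    edge-extension (Graph.sym G e) (SameEdge-end same) B (IsPath-++⁻ˡ B C S-path)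
      (d∉S ∘ ∈-++⁺ˡ B C) (c↛d ∘ Reach-sym)
  short-crossing-witness {r} {c} {d} e same c↛d c↛z S S-path | yes d∈S with ∈⇒Through S d∈S
  ... | through S₁ S₂ with splitAt r _ S₂ (sym (m+[n∸m]≡n (≤-pred (¬Reach⇒longer c↛z (e ∷ S₂)))))
  ...   | split B C refl _ =
    edge-extension e (SameEdge-start same) B (IsPath-++⁻ˡ B C (IsPath-++⁻ʳ S₁ (B ++ C) S-path))
      (start∉-++⁻ʳ S₁ (B ++ C) S-path c≢d ∘ ∈-++⁺ˡ B C) c↛d
    where
    c≢d : c ≢ d
    c≢d refl = irrefl G e

  critical-edge-witness : ∀ {a b p q k r} → (∀ x y → Dist≤ G x y k) → ¬ Reach G′ a b k →
                          ¬ Reach G p q (r + r) → r + r + r < k → Witness (suc r)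
  critical-edge-witness {a} {b} {r = r} dist a↛b p↛q 3r<k with Dist≤⇒path (dist a b)
  ... | Q , Q-path , Q≤k with avoids-or-crosses Q Q-path
  ... | inj₁ Q-avoids = ⊥-elim (a↛b (Reach-mono Q≤k (liftReach Q Q-avoids)))
  ... | inj₂ (crossing {c} {d} w₁ e w₂ same w₁-avoids w₂-avoids) with r ≤? len w₁ + len w₂
  ...   | yes long = long-crossing-witness a↛b w₁ e w₂ Q-path Q≤k w₁-avoids w₂-avoids long
  ...   | no  short with far-vertex r p↛q c
  ...     | z , c↛z with Dist≤⇒path (dist c z)
  ...       | S , S-path , _ = short-crossing-witness e same no-short-detour c↛z S S-path
    where
    no-short-detour : ¬ Reach G′ c d (suc r + r)
    no-short-detour = no-short-bypass a↛b w₁ w₂ w₁-avoids w₂-avoids (detour-bound (≰⇒> short) 3r<k)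

⌈/3⌉≡suc : ∀ k → 2 ≤ k → Σ ℕ λ r → ⌈ k /3⌉ ≡ suc r × r + r + r < k
⌈/3⌉≡suc k 2≤k with ⌈ k /3⌉ | m/n*n≤m (k + 2) 3 | /-monoˡ-≤ 3 (+-monoˡ-≤ 2 (≤-trans (s≤s z≤n) 2≤k))
... | suc r | t*3≤k+2 | _ = r , refl , +-cancelʳ-≤ 2 _ _ (subst (_≤ k + 2) (times-3 r) t*3≤k+2)
  where
  times-3 : ∀ r → suc r * 3 ≡ suc (r + r + r) + 2
  times-3 = solve-∀

open Deletion using (critical-edge-witness)

lemma5p1 : (k : ℕ) → 2 ≤ k → (G : Graph) → DiameterCritical k G →
    (e : Edge G) →
    ∃[ x ] ∃[ y ] (Path G x y ⌈ k /3⌉ × Dist≤ G x y ⌈ k /3⌉ × ¬ Dist≤ (G ─ e) x y ⌈ k /3⌉)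
lemma5p1 k 2≤k G ((dist , p , q , p-q) , critical) (u , v , uv)
  with critical (u , v , uv) | ⌈/3⌉≡suc k 2≤k
... | a , b , a↛b | r , t≡1+r , 3r<k rewrite t≡1+r =
  critical-edge-witness G uv dist (a↛b ∘ Reach⇒Dist≤) (DistEq⇒¬Reach p-q 2r<k) 3r<k
  where
  2r<k : r + r < k
  2r<k = ≤-<-trans (m≤m+n (r + r) r) 3r<k
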